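{- Let $R$ be a commutative ring with unity, $P=\sum_\alpha c_\alpha\boldsymbol{x}^\alpha\in R[x_1,\dots,x_n]$, and let $(J_0,\dots,J_l,d_0,\dots,d_{l-1})$ be a complete Rado functional for $P$. Set $d_l=0$, $\overline{c}_i=\sum_{\alpha\in J_i}c_\alpha$ for $i\in\{0,\dots,l\}$, and $Q_{P,\mathcal{J}}(w)=\sum_{i=0}^{l}\overline{c}_i w^{d_i}$. Suppose that $S\subseteq R$ is infinite and closed under exponentiation, and that $Q_{P,\mathcal{J}}$ has a root in $S$. Then $P$ is partition regular over $S$, i.e. for every finite coloring $c$ of $S$ there are $c$-monochromatic $a_1,\dots,a_n\in S$ with $P(a_1,\dots,a_n)=0$.
   Context: $\operatorname{supp}(P)=\{\alpha\in\mathbb{N}_0^n:c_\alpha\ne0\}$. For $\alpha\in\mathbb{N}_0^n$, $\vec t\in\mathbb{N}^n$, $\alpha\cdot\vec t=\sum_j\alpha(j)t_j$. $\vec t$ is $c$-monochromatic for a coloring $c$ of $\mathbb{N}$ if all $t_j$ get the same color. A complete Rado functional for $P$ is a tuple $(J_0,\dots,J_l,d_0,\dots,d_{l-1})$, where $J_0,\dots,J_l$ is a partition of $\operatorname{supp}(P)$ into nonempty sets and $d_i\in\mathbb{N}$, such that for every finite coloring $c$ of $\mathbb{N}$ there are infinitely many $c$-monochromatic $\vec t\in\mathbb{N}^n$ for which there exist integers $M_0>M_1>\dots>M_l$ with $J_i=\{\alpha\in\operatorname{supp}(P):\alpha\cdot\vec t=M_i\}$ for all $i$ and $M_i-M_l=d_i$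 for all $i\in\{0,\dots,l-1\}$. A set $S\subseteq R$ is closed under exponentiation if $s^k\in S$ for all $s\in S$ and $k\in\mathbb{N}$. -}

module Defs where

open import Level using (Level; _⊔_)
open import Algebra.Bundles using (CommutativeRing)
open import Data.Nat as ℕ using (ℕ; zero; suc; _≤_)
open import Data.Integer as ℤ using (ℤ; +_)
open import Data.Fin as Fin using (Fin; zero; suc; inject₁; fromℕ; _≟_)
open import Data.Vec as Vec using (Vec; lookup)
open import Data.List as List using (List; []; _∷_; allFin)
open import Data.List.Membership.Propositional using (_∈_; _∉_)
open import Data.List.Relation.Unary.Unique.Propositional using (Unique)
open import Data.Product using (Σ; ∃; _×_; _,_)
open import Data.Bool using (if_then_else_)
open import Relation.Nullary using (¬_; does)
open import Relation.Binary.PropositionalEquality using (_≡_)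
open import Function.Bundles using (_⇔_)

dot : {n : ℕ} → Vec ℕ n → Vec ℕ n → ℕ
dot α t = Vec.sum (Vec.zipWith ℕ._*_ α t)

dext : {l : ℕ} → (Fin l → ℕ) → Fin (suc l) → ℕ
dext {zero}  d zero    = 0
dext {suc l} d zero    = d zero
dext {suc l} d (suc i) = dext (λ j → d (suc j)) i

-- The partition of the
-- support into J_0,…,J_l is encoded by the index map J (α ∈ J_i ⇔ J α ≡ i),
-- whose fibres over the support must be nonempty.  Colorings of ℕ are maps
-- ℕ → Fin k; "infinitely many t" = outside every finite list of vectors.
IsCompleteRadoFunctional : {n : ℕ} (A : List (Vec ℕ n)) (l : ℕ)
  (J : Vec ℕ n → Fin (suc l)) (d : Fin l → ℕ) → Set
IsCompleteRadoFunctional {n} A l J d =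
  (∀ (i : Fin (suc l)) → ∃ λ α → α ∈ A × J α ≡ i) ×
  (∀ (i : Fin l) → 1 ≤ d i) ×
  (∀ (k : ℕ) (col : ℕ → Fin k) (L : List (Vec ℕ n)) →
     ∃ λ (t : Vec ℕ n) →
       t ∉ L ×
       (∀ j → 1 ≤ lookup t j) ×
       (∀ i j → col (lookup t i) ≡ col (lookup t j)) ×
       ∃ λ (M : Fin (suc l) → ℤ) →
         (∀ (i : Fin l) → M (suc i) ℤ.< M (inject₁ i)) ×
         (∀ α → α ∈ A → ∀ (i : Fin (suc l)) → (J α ≡ i ⇔ (+ dot α t) ≡ M i)) ×
         (∀ (i : Fin l) → M (inject₁ i) ≡ M (fromℕ l) ℤ.+ + d i))

module _ {c ℓ : Level} (R : CommutativeRing c ℓ) where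
  open CommutativeRing R

  pow : Carrier → ℕ → Carrier
  pow x zero    = 1#
  pow x (suc k) = x * pow x k

  sumL : {a : Level} {X : Set a} → List X → (X → Carrier) → Carrier
  sumL []       f = 0#
  sumL (x ∷ xs) f = f x + sumL xs f

  monomial : {n : ℕ} → Vec ℕ n → (Fin n → Carrier) → Carrier
  monomial α a = List.foldr _*_ 1# (List.map (λ j → pow (a j) (lookup α j)) (allFin _))

  record Poly (n : ℕ) : Set (c ⊔ ℓ) where
    field
      coeff     : Vec ℕ n → Carrier
      supp      : List (Vec ℕ n)
      supp-uniq : Unique supp
      supp-spec : ∀ α → (α ∈ supp ⇔ (¬ coeff α ≈ 0#))
  open Poly public

  eval : {n : ℕ} → Poly n → (Fin n → Carrier) → Carrier
  eval P a = sumL (supp P) (λ α → coeff P α * monomial α a)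

  cbar : {n l : ℕ} → Poly n → (Vec ℕ n → Fin (suc l)) → Fin (suc l) → Carrier
  cbar P J i = sumL (supp P) (λ α → if does (J α ≟ i) then coeff P α else 0#)

  QPJ : {n l : ℕ} → Poly n → (Vec ℕ n → Fin (suc l)) → (Fin l → ℕ) → Carrier → Carrier
  QPJ {l = l} P J d w = sumL (allFin (suc l)) (λ i → cbar P J i * pow w (dext d i))

  RespectsEq : {s : Level} → (Carrier → Set s) → Set _
  RespectsEq S = ∀ x y → x ≈ y → S x → S y

  InfiniteSubset : {s : Level} → (Carrier → Set s) → Set _
  InfiniteSubset S = ∀ (L : List Carrier) → ∃ λ x → S x × (∀ y → y ∈ L → ¬ x ≈ y)

  ClosedUnderExp : {s : Level} → (Carrier → Set s) → Set _
  ClosedUnderExp S = ∀ x → S x → ∀ (k : ℕ) → 1 ≤ k → S (pow x k)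

  PartitionRegularOver : {n : ℕ} {s : Level} → Poly n → (Carrier → Set s) → Set _
  PartitionRegularOver {n} P S =
    ∀ (k : ℕ) (col : (x : Carrier) → S x → Fin k) →
      (∀ x y (Sx : S x) (Sy : S y) → x ≈ y → col x Sx ≡ col y Sy) →
      ∃ λ (a : Fin n → Carrier) → Σ (∀ j → S (a j)) λ Sa →
        (∀ i j → col (a i) (Sa i) ≡ col (a j) (Sa j)) × eval P a ≈ 0#

-- Let w ∈ S be a root of Q_{P,J}.  Pull the coloring of S back to ℕ along k ↦ w^k and let
-- t be a monochromatic vector supplied by the complete Rado functional.  On the support
-- α · t = M_{J α} = M_l + d_{J α}, so at a_j = w^{t_j} every monomial of J_i equals
-- w^{M_l} · w^{d_i}, hence P(a) = w^{M_l} · Q_{P,J}(w) = 0; and all a_j lie in S and share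
-- the color of t.
module Submission where

open import Defs
open import Level using (Level)
open import Algebra.Bundles using (CommutativeRing)
open import Data.Nat as ℕ using (ℕ; zero; suc; _≤_; s≤s; z≤n)
import Data.Nat.Properties as ℕ
open import Data.Fin using (Fin; zero; suc; inject₁; fromℕ; _≟_)
open import Data.Vec using (Vec; []; _∷_; lookup)
open import Data.List as List using (List; []; _∷_)
import Data.List.Properties as List
open import Data.List.Membership.Propositional using (_∈_)
open import Data.List.Relation.Unary.Any using (here; there)
open import Data.Product using (∃; _×_; _,_)
open import Data.Bool using (if_then_else_)
open import Function.Base using (id; _∘_)
open import Function.Bundles using (Equivalence)
open import Relation.Nullary using (does)
open import Relation.Binary.PropositionalEquality as ≡ using (_≡_; cong)

module EvaluationAtPowers {c ℓ : Level} (R : CommutativeRing c ℓ) where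
  open CommutativeRing R hiding (zero)
  open import Algebra.Properties.Semiring.Exp semiring using (_^_; ^-homo-*; ^-assocʳ)
  open import Algebra.Properties.Semiring.Sum semiring
    using (sum; sum-syntax; sum-cong-≋; sum-replicate-zero; ∑-distrib-+)
  open import Algebra.Properties.CommutativeSemigroup *-commutativeSemigroup using (x∙yz≈y∙xz)
  open import Relation.Binary.Reasoning.Setoid setoid

  pow≡^ : ∀ x k → pow R x k ≡ x ^ k
  pow≡^ x zero    = ≡.refl
  pow≡^ x (suc k) = cong (x *_) (pow≡^ x k)

  pow-homo-* : ∀ x m n → pow R x (m ℕ.+ n) ≈ pow R x m * pow R x n
  pow-homo-* x m n
    rewrite pow≡^ x (m ℕ.+ n) | pow≡^ x m | pow≡^ x n = ^-homo-* x m n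

  pow-assocʳ : ∀ x m n → pow R (pow R x m) n ≈ pow R x (n ℕ.* m)
  pow-assocʳ x m n
    rewrite pow≡^ (pow R x m) n | pow≡^ x m | pow≡^ x (n ℕ.* m) | ℕ.*-comm n m =
    ^-assocʳ x m n

  product-pow : ∀ w {n} (α t : Vec ℕ n) →
    List.foldr _*_ 1# (List.tabulate (λ j → pow R (pow R w (lookup t j)) (lookup α j)))
      ≈ pow R w (dot α t)
  product-pow w []      []      = refl
  product-pow w (a ∷ α) (b ∷ t) = begin
    pow R (pow R w b) a * _                ≈⟨ *-cong (pow-assocʳ w b a) (product-pow w α t) ⟩
    pow R w (a ℕ.* b) * pow R w (dot α t)  ≈⟨ pow-homo-* w (a ℕ.* b) (dot α t) ⟨
    pow R w (a ℕ.* b ℕ.+ dot α t)          ∎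

  monomial-pow : ∀ w {n} (α t : Vec ℕ n) →
    monomial R α (λ j → pow R w (lookup t j)) ≈ pow R w (dot α t)
  monomial-pow w α t
    rewrite List.map-tabulate id (λ j → pow R (pow R w (lookup t j)) (lookup α j)) =
    product-pow w α t

  sumL-cong : ∀ {a} {X : Set a} (xs : List X) {f g : X → Carrier} →
    (∀ x → x ∈ xs → f x ≈ g x) → sumL R xs f ≈ sumL R xs g
  sumL-cong []       f≈g = refl
  sumL-cong (x ∷ xs) f≈g = +-cong (f≈g x (here ≡.refl)) (sumL-cong xs (λ y → f≈g y ∘ there))

  *-distribˡ-sumL : ∀ {a} {X : Set a} (xs : List X) y (f : X → Carrier) →
    y * sumL R xs f ≈ sumL R xs (λ x → y * f x)
  *-distribˡ-sumL []       y f = zeroʳ y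
  *-distribˡ-sumL (x ∷ xs) y f = trans (distribˡ y _ _) (+-congˡ (*-distribˡ-sumL xs y f))

  sumL-tabulate : ∀ {a} {X : Set a} {n} (f : Fin n → X) (g : X → Carrier) →
    sumL R (List.tabulate f) g ≡ ∑[ i < n ] g (f i)
  sumL-tabulate {n = zero}  f g = ≡.refl
  sumL-tabulate {n = suc n} f g = cong (g (f zero) +_) (sumL-tabulate (f ∘ suc) g)

  ∑-indicator : ∀ {m} (j : Fin m) (y : Carrier) (h : Fin m → Carrier) →
    ∑[ i < m ] ((if does (j ≟ i) then y else 0#) * h i) ≈ y * h j
  ∑-indicator {suc m} zero y h = begin
    y * h zero + ∑[ i < m ] (0# * h (suc i))
      ≈⟨ +-congˡ (trans (sum-cong-≋ (zeroˡ ∘ h ∘ suc)) (sum-replicate-zero m)) ⟩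
    y * h zero + 0#    ≈⟨ +-identityʳ _ ⟩
    y * h zero         ∎
  ∑-indicator {suc m} (suc j) y h = begin
    0# * h zero + _    ≈⟨ +-cong (zeroˡ (h zero)) (∑-indicator j y (h ∘ suc)) ⟩
    0# + y * h (suc j) ≈⟨ +-identityˡ _ ⟩
    y * h (suc j)      ∎

  ∑-fibres : ∀ {a} {X : Set a} {m} (xs : List X) (g : X → Fin m) (f : X → Carrier)
    (h : Fin m → Carrier) →
    ∑[ i < m ] (sumL R xs (λ x → if does (g x ≟ i) then f x else 0#) * h i)
      ≈ sumL R xs (λ x → f x * h (g x))
  ∑-fibres {m = m} [] g f h =
    trans (sum-cong-≋ (zeroˡ ∘ h)) (sum-replicate-zero m)
  ∑-fibres {m = m} (x ∷ xs) g f h = begin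
    ∑[ i < m ] ((indicator x i + fibre i) * h i)
      ≈⟨ sum-cong-≋ (λ i → distribʳ (h i) _ _) ⟩
    ∑[ i < m ] (indicator x i * h i + fibre i * h i)
      ≈⟨ ∑-distrib-+ (λ i → indicator x i * h i) (λ i → fibre i * h i) ⟩
    ∑[ i < m ] (indicator x i * h i) + ∑[ i < m ] (fibre i * h i)
      ≈⟨ +-cong (∑-indicator (g x) (f x) h) (∑-fibres xs g f h) ⟩
    f x * h (g x) + sumL R xs (λ y → f y * h (g y)) ∎
    where
    indicator : _ → Fin m → Carrier
    indicator y i = if does (g y ≟ i) then f y else 0#
    fibre : Fin m → Carrier
    fibre i = sumL R xs (λ y → indicator y i)

  QPJ≈sumL : ∀ {n l} (P : Poly R n) (J : Vec ℕ n → Fin (suc l)) (d : Fin l → ℕ) w →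
    QPJ R P J d w ≈ sumL R (supp P) (λ α → coeff P α * pow R w (dext d (J α)))
  QPJ≈sumL P J d w = begin
    QPJ R P J d w ≡⟨ sumL-tabulate id (λ i → cbar R P J i * pow R w (dext d i)) ⟩
    _             ≈⟨ ∑-fibres (supp P) J (coeff P) (pow R w ∘ dext d) ⟩
    _             ∎

  eval-pow≈pow*QPJ : ∀ {n l} (P : Poly R n) (J : Vec ℕ n → Fin (suc l)) (d : Fin l → ℕ)
    w (t : Vec ℕ n) m → (∀ α → α ∈ supp P → dot α t ≡ m ℕ.+ dext d (J α)) →
    eval R P (λ j → pow R w (lookup t j)) ≈ pow R w m * QPJ R P J d w
  eval-pow≈pow*QPJ P J d w t m levels = begin
    eval R P (λ j → pow R w (lookup t j))
      ≈⟨ sumL-cong (supp P) (λ α α∈ → *-congˡ (monomial≈ α α∈)) ⟩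
    sumL R (supp P) (λ α → coeff P α * (pow R w m * pow R w (dext d (J α))))
      ≈⟨ sumL-cong (supp P) (λ α _ → x∙yz≈y∙xz (coeff P α) _ _) ⟩
    sumL R (supp P) (λ α → pow R w m * (coeff P α * pow R w (dext d (J α))))
      ≈⟨ *-distribˡ-sumL (supp P) (pow R w m) _ ⟨
    pow R w m * sumL R (supp P) (λ α → coeff P α * pow R w (dext d (J α)))
      ≈⟨ *-congˡ (QPJ≈sumL P J d w) ⟨
    pow R w m * QPJ R P J d w ∎
    where
    monomial≈ : ∀ α → α ∈ supp P →
      monomial R α (λ j → pow R w (lookup t j)) ≈ pow R w m * pow R w (dext d (J α))
    monomial≈ α α∈ = begin
      monomial R α _                      ≈⟨ monomial-pow w α t ⟩
      pow R w (dot α t)                   ≡⟨ cong (pow R w) (levels α α∈) ⟩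
      pow R w (m ℕ.+ dext d (J α))        ≈⟨ pow-homo-* w m (dext d (J α)) ⟩
      pow R w m * pow R w (dext d (J α))  ∎

open EvaluationAtPowers

module RadoLevels where
  open import Data.Integer as ℤ using (ℤ; +_)
  import Data.Integer.Properties as ℤ

  M≡M-last+dext : ∀ {l} (d : Fin l → ℕ) (M : Fin (suc l) → ℤ) →
    (∀ i → M (inject₁ i) ≡ M (fromℕ l) ℤ.+ + d i) →
    ∀ i → M i ≡ M (fromℕ l) ℤ.+ + dext d i
  M≡M-last+dext {zero}  d M M≡ zero    = ≡.sym (ℤ.+-identityʳ (M zero))
  M≡M-last+dext {suc l} d M M≡ zero    = M≡ zero
  M≡M-last+dext {suc l} d M M≡ (suc i) =
    M≡M-last+dext (d ∘ suc) (M ∘ suc) (M≡ ∘ suc) i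

  -- M_l is a natural number because it is the value α₀ · t of some α₀ ∈ J_l.
  rado-levels : ∀ {n} {A : List (Vec ℕ n)} {l} {J : Vec ℕ n → Fin (suc l)} {d : Fin l → ℕ} →
    IsCompleteRadoFunctional A l J d → ∀ k (col : ℕ → Fin k) →
    ∃ λ (t : Vec ℕ n) → (∀ j → 1 ≤ lookup t j) ×
      (∀ i j → col (lookup t i) ≡ col (lookup t j)) ×
      ∃ λ m → ∀ α → α ∈ A → dot α t ≡ m ℕ.+ dext d (J α)
  rado-levels {l = l} {J} {d} (fibres , _ , rado) k col
    with rado k col []
  ... | t , _ , t≥1 , mono , M , _ , M↔dot , M≡ with fibres (fromℕ l)
  ...   | α₀ , α₀∈ , Jα₀≡l = t , t≥1 , mono , dot α₀ t , levels
    where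
    levels : ∀ α → α ∈ _ → dot α t ≡ dot α₀ t ℕ.+ dext d (J α)
    levels α α∈ = ℤ.+-injective (begin
      + dot α t                       ≡⟨ Equivalence.to (M↔dot α α∈ (J α)) ≡.refl ⟩
      M (J α)                         ≡⟨ M≡M-last+dext d M M≡ (J α) ⟩
      M (fromℕ l) ℤ.+ + dext d (J α)  ≡⟨ cong (ℤ._+ _) (Equivalence.to (M↔dot α₀ α₀∈ (fromℕ l)) Jα₀≡l) ⟨
      + dot α₀ t ℤ.+ + dext d (J α)   ≡⟨ ℤ.pos-+ (dot α₀ t) (dext d (J α)) ⟨
      + (dot α₀ t ℕ.+ dext d (J α))   ∎)
      where open ≡.≡-Reasoning

open RadoLevels

-- Exponent 0 never occurs in the vectors used; it is colored like w^1 only to make the map total.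
pow-coloring : ∀ {c ℓ s} (R : CommutativeRing c ℓ) {S : CommutativeRing.Carrier R → Set s} →
  ClosedUnderExp R S → ∀ {w} → S w → ∀ {k} → ((x : CommutativeRing.Carrier R) → S x → Fin k) →
  ℕ → Fin k
pow-coloring R closed {w} Sw col zero    = col (pow R w 1) (closed w Sw 1 (s≤s z≤n))
pow-coloring R closed {w} Sw col (suc m) = col (pow R w (suc m)) (closed w Sw (suc m) (s≤s z≤n))

theorem3p4 : {c ℓ : Level} (R : CommutativeRing c ℓ) {n : ℕ} (P : Poly R n)
    (l : ℕ) (J : Vec ℕ n → Fin (suc l)) (d : Fin l → ℕ) →
    IsCompleteRadoFunctional (supp P) l J d →
    {s : Level} (S : CommutativeRing.Carrier R → Set s) →
    RespectsEq R S → InfiniteSubset R S → ClosedUnderExp R S →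
    (∃ λ w → S w × CommutativeRing._≈_ R (QPJ R P J d w) (CommutativeRing.0# R)) →
    PartitionRegularOver R P S
theorem3p4 R P l J d rado S _ _ closed (w , Sw , Qw≈0) k col col-resp
  with rado-levels rado k (pow-coloring R closed Sw col)
... | t , t≥1 , mono , m , levels = a , Sa , monoA , P[a]≈0
  where
  open CommutativeRing R hiding (zero)
  open import Relation.Binary.Reasoning.Setoid setoid
  a : Fin _ → Carrier
  a j = pow R w (lookup t j)
  Sa : ∀ j → S (a j)
  Sa j = closed w Sw (lookup t j) (t≥1 j)
  col-a : ∀ j → col (a j) (Sa j) ≡ pow-coloring R closed Sw col (lookup t j)
  col-a j with lookup t j | t≥1 j
  ... | suc _ | _ = col-resp _ _ _ _ refl
  monoA : ∀ i j → col (a i) (Sa i) ≡ col (a j) (Sa j)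
  monoA i j = ≡.trans (col-a i) (≡.trans (mono i j) (≡.sym (col-a j)))
  P[a]≈0 : eval R P a ≈ 0#
  P[a]≈0 = begin
    eval R P a                 ≈⟨ eval-pow≈pow*QPJ R P J d w t m levels ⟩
    pow R w m * QPJ R P J d w  ≈⟨ *-congˡ Qw≈0 ⟩
    pow R w m * 0#             ≈⟨ zeroʳ _ ⟩
    0#                         ∎
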